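{- Let $\mu$ be a doubling measure on $\mathbb Z$ with $C^0_\mu=3$, and set $a_j=\mu(j)$. If there is $j_0\in\mathbb Z$ with $a_{j_0}<a_{j_0+1}$, then $a_j<a_{j+1}$ for every $j\le j_0$.
   Context: $\mathbb Z$ is viewed as the infinite path graph with edges $\{j,j+1\}$, with distance $d(i,j)=|i-j|$. A measure $\mu$ is a weight function $\mu:\mathbb Z\to(0,\infty)$, $\mu(A)=\sum_{v\in A}\mu(v)$; $B(x,r)=\{y:d(x,y)\le r\}$. $\mu$ is doubling if $C_\mu=\sup\{\mu(B(x,2k+1))/\mu(B(x,k)):x\in\mathbb Z,k\in\{0,1,\dots\}\}<\infty$, and $C^0_\mu=\sup_x\mu(B(x,1))/\mu(x)$. -}

module Defs where

open import Data.Nat using (ℕ; zero; suc)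
open import Data.Integer as Z using (ℤ; +_)
open import Data.Product using (Σ; ∃; _×_; _,_)
open import Data.Sum using (_⊎_)
open import Relation.Binary.PropositionalEquality using (_≡_)
open import Relation.Nullary using (¬_)

-- The real numbers, axiomatised as a complete ordered field
-- (any model is isomorphic to ℝ).  Equality is propositional.
record RealField : Set₁ where
  infixl 6 _+_
  infixl 7 _*_
  infix  4 _<_ _≤_
  field
    Carrier : Set
    0# 1#   : Carrier
    _+_ _*_ : Carrier → Carrier → Carrier
    -_      : Carrier → Carrier
    _⁻¹     : Carrier → Carrier
    _<_     : Carrier → Carrier → Set
    +-assoc    : ∀ x y z → (x + y) + z ≡ x + (y + z)
    +-comm     : ∀ x y → x + y ≡ y + x
    +-identity : ∀ x → 0# + x ≡ x
    +-inverse  : ∀ x → (- x) + x ≡ 0#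
    *-assoc    : ∀ x y z → (x * y) * z ≡ x * (y * z)
    *-comm     : ∀ x y → x * y ≡ y * x
    *-identity : ∀ x → 1# * x ≡ x
    *-inverse  : ∀ x → ¬ (x ≡ 0#) → (x ⁻¹) * x ≡ 1#
    distrib    : ∀ x y z → x * (y + z) ≡ x * y + x * z
    0≢1        : ¬ (0# ≡ 1#)
    <-irrefl   : ∀ x → ¬ (x < x)
    <-trans    : ∀ {x y z} → x < y → y < z → x < z
    <-trichotomy : ∀ x y → x < y ⊎ x ≡ y ⊎ y < x
    +-mono-<   : ∀ {x y} z → x < y → x + z < y + z
    *-pos      : ∀ {x y} → 0# < x → 0# < y → 0# < x * y

  _≤_ : Carrier → Carrier → Set
  x ≤ y = x < y ⊎ x ≡ y

  UpperBound : (Carrier → Set) → Carrier → Set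
  UpperBound P b = ∀ x → P x → x ≤ b

  IsSup : (Carrier → Set) → Carrier → Set
  IsSup P s = UpperBound P s × (∀ b → UpperBound P b → s ≤ b)

  field
    completeness : (P : Carrier → Set) → ∃ P → ∃ (UpperBound P) → ∃ (IsSup P)

  3# : Carrier
  3# = 1# + 1# + 1#

module Measure (R : RealField) where
  open RealField R

  sumFrom : (ℤ → Carrier) → ℤ → ℕ → Carrier
  sumFrom f s zero    = 0#
  sumFrom f s (suc n) = f s + sumFrom f (s Z.+ + 1) n

  -- μ(B(x,k)) where B(x,k) = {x-k, …, x+k} in the path graph ℤ
  ballMeasure : (ℤ → Carrier) → ℤ → ℕ → Carrier
  ballMeasure μ x k = sumFrom μ (x Z.- + k) (suc (k Data.Nat.+ k))

  IsMeasure : (ℤ → Carrier) → Set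
  IsMeasure μ = ∀ v → 0# < μ v

  -- the set of ratios μ(B(x,2k+1)) / μ(B(x,k))
  DoublingRatio : (ℤ → Carrier) → Carrier → Set
  DoublingRatio μ r = Σ ℤ λ x → Σ ℕ λ k →
    r * ballMeasure μ x k ≡ ballMeasure μ x (suc (k Data.Nat.+ k))

  IsDoubling : (ℤ → Carrier) → Set
  IsDoubling μ = ∃ (UpperBound (DoublingRatio μ))

  -- the set of ratios μ(B(x,1)) / μ(x)
  C0Ratio : (ℤ → Carrier) → Carrier → Set
  C0Ratio μ r = Σ ℤ λ x → r * μ x ≡ ballMeasure μ x 1

  C0Is : (ℤ → Carrier) → Carrier → Set
  C0Is μ c = IsSup (C0Ratio μ) c

-- Since C⁰_μ = 3, every ball of radius 1 satisfies μ(j−1) + μ(j) + μ(j+1) ≤ 3 μ(j).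
-- If μ(j) < μ(j+1), this forces μ(j−1) < μ(j), and downward induction from j₀
-- finishes the proof.
module Submission where

open import Defs
open import Data.Product using (_,_)
open import Data.Sum using (inj₁; inj₂)
open import Relation.Binary.PropositionalEquality
open import Relation.Nullary using (¬_)

module OrderedFieldProperties (R : RealField) where
  open RealField R

  +-identityʳ : ∀ x → x + 0# ≡ x
  +-identityʳ x = trans (+-comm x 0#) (+-identity x)

  +-inverseʳ : ∀ x → x + (- x) ≡ 0#
  +-inverseʳ x = trans (+-comm x (- x)) (+-inverse x)

  +-cancelʳ-< : ∀ {x y} z → x + z < y + z → x < y
  +-cancelʳ-< {x} {y} z x+z<y+z = subst₂ _<_ (cancel x) (cancel y) (+-mono-< (- z) x+z<y+z)
    where
    cancel : ∀ w → w + z + (- z) ≡ w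
    cancel w = trans (+-assoc w z (- z)) (trans (cong (w +_) (+-inverseʳ z)) (+-identityʳ w))

  +-monoʳ-< : ∀ {x y} z → x < y → z + x < z + y
  +-monoʳ-< {x} {y} z x<y = subst₂ _<_ (+-comm x z) (+-comm y z) (+-mono-< z x<y)

  *-distribʳ-+ : ∀ m x y → (x + y) * m ≡ x * m + y * m
  *-distribʳ-+ m x y = trans (*-comm (x + y) m)
    (trans (distrib m x y) (cong₂ _+_ (*-comm m x) (*-comm m y)))

  -- (y − x) m > 0 and (y − x) m + x m = y m.
  *-monoˡ-< : ∀ {m x y} → 0# < m → x < y → x * m < y * m
  *-monoˡ-< {m} {x} {y} 0<m x<y =
    subst₂ _<_ (+-identity (x * m)) [y-x]m+xm≡ym (+-mono-< (x * m) 0<[y-x]m)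
    where
    open ≡-Reasoning
    0<[y-x]m : 0# < (y + (- x)) * m
    0<[y-x]m = *-pos (subst₂ _<_ (+-inverseʳ x) refl (+-mono-< (- x) x<y)) 0<m
    [y-x]m+xm≡ym : (y + (- x)) * m + x * m ≡ y * m
    [y-x]m+xm≡ym = begin
      (y + (- x)) * m + x * m     ≡⟨ sym (*-distribʳ-+ m (y + (- x)) x) ⟩
      (y + (- x) + x) * m         ≡⟨ cong (_* m) (+-assoc y (- x) x) ⟩
      (y + ((- x) + x)) * m       ≡⟨ cong (λ t → (y + t) * m) (+-inverse x) ⟩
      (y + 0#) * m                ≡⟨ cong (_* m) (+-identityʳ y) ⟩
      y * m                       ∎

  *-monoˡ-≤ : ∀ {m x y} → 0# < m → x ≤ y → x * m ≤ y * m
  *-monoˡ-≤ 0<m (inj₁ x<y) = inj₁ (*-monoˡ-< 0<m x<y)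
  *-monoˡ-≤ 0<m (inj₂ refl) = inj₂ refl

  <-≤-trans : ∀ {x y z} → x < y → y ≤ z → x < z
  <-≤-trans x<y (inj₁ y<z) = <-trans x<y y<z
  <-≤-trans x<y (inj₂ refl) = x<y

  0<⇒≢0 : ∀ {x} → 0# < x → ¬ (x ≡ 0#)
  0<⇒≢0 {x} 0<x refl = <-irrefl 0# 0<x

  *-⁻¹-cancelʳ : ∀ x {m} → ¬ (m ≡ 0#) → x * m ⁻¹ * m ≡ x
  *-⁻¹-cancelʳ x {m} m≢0 = trans (*-assoc x (m ⁻¹) m)
    (trans (cong (x *_) (*-inverse m m≢0)) (trans (*-comm x 1#) (*-identity x)))

  3*x≡x+x+x : ∀ x → 3# * x ≡ x + x + x
  3*x≡x+x+x x = trans (*-distribʳ-+ x (1# + 1#) 1#)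
    (cong₂ _+_ (trans (*-distribʳ-+ x 1# 1#) (cong₂ _+_ (*-identity x) (*-identity x)))
               (*-identity x))

  below-average-left : ∀ {a b c} → b < c → a + (b + (c + 0#)) ≤ 3# * b → a < b
  below-average-left {a} {b} {c} b<c sum≤3b =
    +-cancelʳ-< b (+-cancelʳ-< b (<-≤-trans a+b+b<sum (subst (_ ≤_) (3*x≡x+x+x b) sum≤3b)))
    where
    rearrange : a + c + b ≡ a + (b + (c + 0#))
    rearrange = trans (+-assoc a c b)
      (cong (a +_) (trans (+-comm c b) (cong (b +_) (sym (+-identityʳ c)))))
    a+b+b<sum : a + b + b < a + (b + (c + 0#))
    a+b+b<sum = subst₂ _<_ refl rearrange (+-mono-< b (+-monoʳ-< a b<c))

open import Data.Integer using (ℤ; +_; _+_; _-_; _≤_; ∣_∣)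
open import Data.Integer.Properties using (+-assoc; +-identityʳ; ∣-∣-≤)
open import Data.Integer.Tactic.RingSolver using (solve-∀)
open import Data.Nat using (zero; suc)

downward-induction : ∀ {ℓ} (P : ℤ → Set ℓ) → (∀ i → P (i + + 1) → P i) →
                     ∀ {j j₀} → j ≤ j₀ → P j₀ → P j
downward-induction P step {j} {j₀} j≤j₀ Pj₀ = from-offset _ j (subst P (sym j+n≡j₀) Pj₀)
  where
  from-offset : ∀ n i → P (i + + n) → P i
  from-offset zero    i P[i+0]   = subst P (+-identityʳ i) P[i+0]
  from-offset (suc n) i P[i+1+n] =
    step i (from-offset n (i + + 1) (subst P (sym (+-assoc i (+ 1) (+ n))) P[i+1+n]))

  j+n≡j₀ : j + + ∣ j - j₀ ∣ ≡ j₀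
  j+n≡j₀ = trans (cong (_+_ j) (∣-∣-≤ j≤j₀)) (i+[k-i]≡k j j₀)
    where
    i+[k-i]≡k : ∀ i k → i + (k - i) ≡ k
    i+[k-i]≡k = solve-∀

module C0Properties (R : RealField) (μ : ℤ → RealField.Carrier R) where
  open RealField R using (_<_; _*_; _⁻¹; 0#; 3#) renaming (_+_ to _+ᴿ_; _≤_ to _≤ᴿ_)
  open Measure R
  open OrderedFieldProperties R

  ballMeasure₁-≤-C0 : ∀ {c} → IsMeasure μ → C0Is μ c → ∀ x → ballMeasure μ x 1 ≤ᴿ c * μ x
  ballMeasure₁-≤-C0 {c} μ>0 (c-upper , _) x =
    subst (_≤ᴿ c * μ x) ratio*μx≡ball (*-monoˡ-≤ (μ>0 x) (c-upper ratio (x , ratio*μx≡ball)))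
    where
    ratio = ballMeasure μ x 1 * μ x ⁻¹
    ratio*μx≡ball : ratio * μ x ≡ ballMeasure μ x 1
    ratio*μx≡ball = *-⁻¹-cancelʳ _ (0<⇒≢0 (μ>0 x))

  ballMeasure₁-expand : ∀ y → ballMeasure μ (y + + 1) 1 ≡ μ y +ᴿ (μ (y + + 1) +ᴿ (μ (y + + 1 + + 1) +ᴿ 0#))
  ballMeasure₁-expand y = cong (λ s → sumFrom μ s 3) (i+1-1≡i y)
    where
    i+1-1≡i : ∀ i → i + + 1 - + 1 ≡ i
    i+1-1≡i = solve-∀

  increasing-propagates-left : IsMeasure μ → C0Is μ 3# →
                               ∀ y → μ (y + + 1) < μ (y + + 1 + + 1) → μ y < μ (y + + 1)
  increasing-propagates-left μ>0 C0≡3 y increasing =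
    below-average-left increasing
      (subst (_≤ᴿ 3# * μ (y + + 1)) (ballMeasure₁-expand y) (ballMeasure₁-≤-C0 μ>0 C0≡3 (y + + 1)))

lemma4p5 : (R : RealField) → (μ : ℤ → RealField.Carrier R)
    → Measure.IsMeasure R μ → Measure.IsDoubling R μ
    → Measure.C0Is R μ (RealField.3# R)
    → (j₀ : ℤ) → RealField._<_ R (μ j₀) (μ (j₀ + + 1))
    → (j : ℤ) → j ≤ j₀ → RealField._<_ R (μ j) (μ (j + + 1))
lemma4p5 R μ μ>0 _ C0≡3 j₀ increasing j j≤j₀ =
  downward-induction (λ i → μ i < μ (i + + 1))
    (C0Properties.increasing-propagates-left R μ μ>0 C0≡3) j≤j₀ increasing
  where open RealField R using (_<_)
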